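{- Every zigzag triangulation $T$ of a convex $n$-gon is permutation-adjacent to each of the (two) stars whose center is an endpoint of $T$.
   Context: Triangulations are of a convex $n$-gon by non-crossing diagonals; a flip replaces an interior diagonal $e$ of a triangulation by the other diagonal of the quadrilateral formed by the two triangles containing $e$. The weak dual of a triangulation is its dual graph with the outer face removed. A zigzag triangulation is one whose weak dual is a path; equivalently every triangle has an edge on the boundary of the polygon. It has exactly two vertices of degree $2$, its endpoints. A star is a triangulation having a vertex (its center) of degree $n-1$. Given a triangulation $T$ and an ordering $\pi$ of its interior diagonals, $T(\pi)$ is the triangulation obtained by flipping the original diagonals of $T$ one after another in the order $\pi$ (each is still present when its turn comes, as only previously flipped diagonals have been removed). Two triangulations $T_1,T_2$ are permutation-adjacent if $T_2=T_1(\pi)$ for some ordering $\pi$ of the interior diagonals of $T_1$. -}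

module Defs where

open import Data.Nat using (ℕ; zero; suc; _+_; _∸_; _<_; _≤_; _≟_)
open import Data.Nat.Base using (_⊓_; _⊔_)
open import Data.Product using (Σ; ∃; ∃-syntax; _×_; _,_; proj₁; proj₂)
open import Data.Sum using (_⊎_)
open import Data.List using (List; []; _∷_; length; filter)
open import Data.List.Membership.Propositional using (_∈_)
open import Data.List.Relation.Unary.All using (All)
open import Data.List.Relation.Unary.Any using (Any)
open import Data.List.Relation.Unary.Unique.Propositional using (Unique)
open import Data.List.Relation.Binary.Permutation.Propositional using (_↭_)
open import Relation.Binary.PropositionalEquality using (_≡_; _≢_)
open import Relation.Nullary using (¬_)
open import Relation.Nullary.Decidable using (_⊎-dec_)
open import Function.Bundles using (_⇔_)

-- Vertices of the convex n-gon are 0,1,…,n-1 in cyclic order.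
-- A segment between two vertices is a pair (i , j) with i < j.
Seg : Set
Seg = ℕ × ℕ

BoundaryEdge : ℕ → ℕ → ℕ → Set
BoundaryEdge n i j = (j ≡ suc i) ⊎ ((i ≡ 0) × (suc j ≡ n))

Diagonal : ℕ → Seg → Set
Diagonal n (i , j) = (i < j) × (j < n) × ¬ BoundaryEdge n i j

Cross : Seg → Seg → Set
Cross (i , j) (k , l) = ((i < k) × (k < j) × (j < l)) ⊎ ((k < i) × (i < l) × (l < j))

-- A triangulation of the convex n-gon, given by its set of (interior)
-- diagonals: a duplicate-free list of pairwise non-crossing diagonals that
-- is maximal (every other diagonal crosses one of them).
record Triangulation (n : ℕ) (T : List Seg) : Set where
  field
    three≤n    : 3 ≤ n
    diagonals  : All (Diagonal n) T
    noDup      : Unique T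
    nonCrossing : ∀ {d e} → d ∈ T → e ∈ T → ¬ Cross d e
    maximal    : ∀ d → Diagonal n d → ¬ (d ∈ T) → Any (Cross d) T

_≈ˢ_ : List Seg → List Seg → Set
A ≈ˢ B = ∀ x → (x ∈ A) ⇔ (x ∈ B)

Side : ℕ → List Seg → ℕ → ℕ → Set
Side n T x y = BoundaryEdge n x y ⊎ BoundaryEdge n y x ⊎ ((x , y) ∈ T) ⊎ ((y , x) ∈ T)

IsTriangle : ℕ → List Seg → ℕ → ℕ → ℕ → Set
IsTriangle n T x y z =
  (x < n) × (y < n) × (z < n) × Side n T x y × Side n T y z × Side n T x z

seg : ℕ → ℕ → Seg
seg c d = (c ⊓ d , c ⊔ d)

Flip : ℕ → List Seg → Seg → List Seg → Set
Flip n T (a , b) T' =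
  ((a , b) ∈ T) ×
  ∃[ c ] ∃[ d ] ((c ≢ d) × IsTriangle n T a b c × IsTriangle n T a b d ×
    (∀ x → (x ∈ T') ⇔ ((x ≡ seg c d) ⊎ ((x ∈ T) × (x ≢ (a , b))))))

FlipSeq : ℕ → List Seg → List Seg → List Seg → Set
FlipSeq n T [] T' = T ≈ˢ T'
FlipSeq n T (e ∷ π) T'' = ∃[ T' ] (Flip n T e T' × FlipSeq n T' π T'')

PermAdjacent : ℕ → List Seg → List Seg → Set
PermAdjacent n T₁ T₂ = ∃[ π ] ((π ↭ T₁) × FlipSeq n T₁ π T₂)

-- degree of vertex v in the triangulation T: its two polygon edges plus
-- the diagonals of T incident to v
incident? : ∀ v (d : Seg) → _
incident? v (i , j) = (i ≟ v) ⊎-dec (j ≟ v)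

degree : List Seg → ℕ → ℕ
degree T v = 2 + length (filter (incident? v) T)

-- zigzag triangulation: every triangle of T has an edge on the polygon
-- boundary (equivalently, the weak dual is a path)
Zigzag : ℕ → List Seg → Set
Zigzag n T = ∀ x y z → IsTriangle n T x y z →
  BoundaryEdge n x y ⊎ BoundaryEdge n y x ⊎ BoundaryEdge n y z ⊎
  BoundaryEdge n z y ⊎ BoundaryEdge n x z ⊎ BoundaryEdge n z x

Endpoint : ℕ → List Seg → ℕ → Set
Endpoint n T v = (v < n) × (degree T v ≡ 2)

Star : ℕ → List Seg → ℕ → Set
Star n S c = Triangulation n S × (c < n) × (degree S c ≡ n ∸ 1)

-- Relabel the polygon so that the endpoint v becomes vertex 0. A star centred at v has
-- n - 3 diagonals at v, so by counting it is the fan of all chords 0 y, 2 ≤ y ≤ n - 2.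
-- Since v has degree 2 in T, no diagonal of T ends at 0, so 1 (n-1) is an edge of T.
-- Now peel T from the outside: if α β is a diagonal of T and 0 α, 0 β are already
-- present, the two triangles on α β are α β 0 and α β w, where w is the apex of the
-- triangle of T beyond α β, so flipping α β produces the fan chord 0 w. As T is a
-- zigzag, that triangle has a polygon side, so w = α + 1 or β = w + 1 and the
-- remaining diagonals of T lie inside one shorter interval. Hence flipping the
-- diagonals of T from the outside in, each once, ends in the fan.

module Submission where

open import Defs
open import Data.Empty using (⊥-elim)
open import Data.List using (List; []; _∷_; length; filter; deduplicate; applyUpTo)
open import Data.List.Membership.Propositional using (_∈_; find)
open import Data.List.Membership.Propositional.Properties
  using (∈-filter⁺; ∈-filter⁻; ∈-deduplicate⁺; ∈-applyUpTo⁺; ∈-length)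
open import Data.List.Membership.Propositional.Properties.WithK using (unique∧set⇒bag)
open import Data.List.Properties using (length-filter; length-deduplicate; length-applyUpTo)
open import Data.List.Relation.Binary.BagAndSetEquality using (∼bag⇒↭)
open import Data.List.Relation.Binary.Permutation.Propositional using (_↭_)
open import Data.List.Relation.Binary.Permutation.Propositional.Properties using (↭-length)
import Data.List.Relation.Unary.All as All
open import Data.List.Relation.Unary.AllPairs using ([]; _∷_)
open import Data.List.Relation.Unary.Any using (here; there)
open import Data.List.Relation.Unary.Unique.Propositional using (Unique)
import Data.List.Relation.Unary.Unique.Propositional.Properties as Unique
open import Data.Nat using (ℕ; zero; suc; pred; _+_; _∸_; _<_; _≤_; _≟_; z≤n; s≤s; >-nonZero)
open import Data.Nat.Properties
open import Data.Product using (∃-syntax; _×_; _,_; proj₁; proj₂; swap)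
open import Data.Product.Properties using (,-injective; ≡-dec)
open import Data.Sum using (_⊎_; inj₁; inj₂)
import Data.Sum as Sum
open import Function.Bundles using (_⇔_; mk⇔; Equivalence)
open import Relation.Binary.Definitions using (DecidableEquality; tri<; tri≈; tri>)
open import Relation.Binary.PropositionalEquality using (_≡_; _≢_; refl; sym; trans; cong; cong₂; subst; subst₂; ≢-sym)
open import Relation.Nullary using (¬_; ¬?; Dec; yes; no)

module _ {A : Set} (_≟ᴬ_ : DecidableEquality A) where
  open import Data.List.Membership.DecPropositional _≟ᴬ_ using (_∈?_)
  open import Data.List.Relation.Unary.Unique.DecPropositional.Properties _≟ᴬ_ using (deduplicate-!; filter⁺)

  unique∧⊆⇒length≤ : ∀ {xs ys : List A} → Unique xs → (∀ {x} → x ∈ xs → x ∈ ys) → length xs ≤ length ys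
  unique∧⊆⇒length≤ {xs} {ys} xs! xs⊆ys = begin
    length xs                    ≡⟨ ↭-length (∼bag⇒↭ (unique∧set⇒bag xs! zs! (mk⇔ to from))) ⟩
    length zs                    ≤⟨ length-filter (_∈? xs) (deduplicate _≟ᴬ_ ys) ⟩
    length (deduplicate _≟ᴬ_ ys) ≤⟨ length-deduplicate _≟ᴬ_ ys ⟩
    length ys                    ∎
    where
    open ≤-Reasoning
    zs : List A
    zs = filter (_∈? xs) (deduplicate _≟ᴬ_ ys)
    zs! : Unique zs
    zs! = filter⁺ (_∈? xs) (deduplicate-! ys)
    to : ∀ {x} → x ∈ xs → x ∈ zs
    to x∈xs = ∈-filter⁺ (_∈? xs) (∈-deduplicate⁺ _≟ᴬ_ (xs⊆ys x∈xs)) x∈xs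
    from : ∀ {x} → x ∈ zs → x ∈ xs
    from x∈zs = proj₂ (∈-filter⁻ (_∈? xs) {xs = deduplicate _≟ᴬ_ ys} x∈zs)

-- Cyclic order and crossing

Cyclic : ℕ → ℕ → ℕ → Set
Cyclic a b c = (a < b × b < c) ⊎ (b < c × c < a) ⊎ (c < a × a < b)

cyclic-rotate : ∀ {a b c} → Cyclic a b c → Cyclic b c a
cyclic-rotate (inj₁ abc) = inj₂ (inj₂ abc)
cyclic-rotate (inj₂ (inj₁ bca)) = inj₁ bca
cyclic-rotate (inj₂ (inj₂ cab)) = inj₂ (inj₁ cab)

cyclic-asym : ∀ {a b c} → Cyclic a b c → ¬ Cyclic a c b
cyclic-asym (inj₁ (a<b , b<c)) (inj₁ (a<c , c<b)) = <-asym b<c c<b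
cyclic-asym (inj₁ (a<b , b<c)) (inj₂ (inj₁ (c<b , b<a))) = <-asym b<c c<b
cyclic-asym (inj₁ (a<b , b<c)) (inj₂ (inj₂ (b<a , a<c))) = <-asym a<b b<a
cyclic-asym (inj₂ (inj₁ (b<c , c<a))) (inj₁ (a<c , c<b)) = <-asym b<c c<b
cyclic-asym (inj₂ (inj₁ (b<c , c<a))) (inj₂ (inj₁ (c<b , b<a))) = <-asym b<c c<b
cyclic-asym (inj₂ (inj₁ (b<c , c<a))) (inj₂ (inj₂ (b<a , a<c))) = <-asym c<a a<c
cyclic-asym (inj₂ (inj₂ (c<a , a<b))) (inj₁ (a<c , c<b)) = <-asym c<a a<c
cyclic-asym (inj₂ (inj₂ (c<a , a<b))) (inj₂ (inj₁ (c<b , b<a))) = <-asym a<b b<a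
cyclic-asym (inj₂ (inj₂ (c<a , a<b))) (inj₂ (inj₂ (b<a , a<c))) = <-asym a<b b<a

cyclic⇒≢ : ∀ {a b c} → Cyclic a b c → a ≢ b
cyclic⇒≢ (inj₁ (a<b , _)) refl = <-irrefl refl a<b
cyclic⇒≢ (inj₂ (inj₁ (b<c , c<a))) refl = <-asym b<c c<a
cyclic⇒≢ (inj₂ (inj₂ (_ , a<b))) refl = <-irrefl refl a<b

cyclic-total : ∀ a b c → a ≢ b → b ≢ c → a ≢ c → Cyclic a b c ⊎ Cyclic a c b
cyclic-total a b c a≢b b≢c a≢c with <-cmp a b | <-cmp b c | <-cmp a c
... | tri≈ _ a≡b _ | _ | _ = ⊥-elim (a≢b a≡b)
... | _ | tri≈ _ b≡c _ | _ = ⊥-elim (b≢c b≡c)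
... | _ | _ | tri≈ _ a≡c _ = ⊥-elim (a≢c a≡c)
... | tri< a<b _ _ | tri< b<c _ _ | _ = inj₁ (inj₁ (a<b , b<c))
... | tri< a<b _ _ | tri> _ _ c<b | tri< a<c _ _ = inj₂ (inj₁ (a<c , c<b))
... | tri< a<b _ _ | tri> _ _ c<b | tri> _ _ c<a = inj₁ (inj₂ (inj₂ (c<a , a<b)))
... | tri> _ _ b<a | tri< b<c _ _ | tri< a<c _ _ = inj₂ (inj₂ (inj₂ (b<a , a<c)))
... | tri> _ _ b<a | tri< b<c _ _ | tri> _ _ c<a = inj₁ (inj₂ (inj₁ (b<c , c<a)))
... | tri> _ _ b<a | tri> _ _ c<b | _ = inj₂ (inj₂ (inj₁ (c<b , b<a)))

-- Unlike Cross, which is stated for sorted pairs, this form of crossing is invariant under rotation.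
Interleaved : ℕ → ℕ → ℕ → ℕ → Set
Interleaved i j k l = (Cyclic i k j × Cyclic i j l) ⊎ (Cyclic i l j × Cyclic i j k)

interleaved-swapˡ : ∀ {i j k l} → Interleaved i j k l → Interleaved j i k l
interleaved-swapˡ (inj₁ (ikj , ijl)) = inj₂ (cyclic-rotate ijl , cyclic-rotate (cyclic-rotate ikj))
interleaved-swapˡ (inj₂ (ilj , ijk)) = inj₁ (cyclic-rotate ijk , cyclic-rotate (cyclic-rotate ilj))

interleaved-swapʳ : ∀ {i j k l} → Interleaved i j k l → Interleaved i j l k
interleaved-swapʳ (inj₁ x) = inj₂ x
interleaved-swapʳ (inj₂ x) = inj₁ x

cross⇒interleaved : ∀ {i j k l} → i < j → k < l → Cross (i , j) (k , l) → Interleaved i j k l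
cross⇒interleaved i<j k<l (inj₁ (i<k , k<j , j<l)) = inj₁ (inj₁ (i<k , k<j) , inj₁ (i<j , j<l))
cross⇒interleaved i<j k<l (inj₂ (k<i , i<l , l<j)) = inj₂ (inj₁ (i<l , l<j) , inj₂ (inj₂ (k<i , i<j)))

interleaved⇒cross : ∀ {i j k l} → i < j → k < l → Interleaved i j k l → Cross (i , j) (k , l)
interleaved⇒cross i<j k<l (inj₁ (inj₁ (i<k , k<j) , inj₁ (_ , j<l))) = inj₁ (i<k , k<j , j<l)
interleaved⇒cross i<j k<l (inj₁ (inj₁ (i<k , _) , inj₂ (inj₁ (_ , l<i)))) = ⊥-elim (<-asym (<-trans i<k k<l) l<i)
interleaved⇒cross i<j k<l (inj₁ (inj₁ (i<k , _) , inj₂ (inj₂ (l<i , _)))) = ⊥-elim (<-asym (<-trans i<k k<l) l<i)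
interleaved⇒cross i<j k<l (inj₁ (inj₂ (inj₁ (_ , j<i)) , _)) = ⊥-elim (<-asym i<j j<i)
interleaved⇒cross i<j k<l (inj₁ (inj₂ (inj₂ (j<i , _)) , _)) = ⊥-elim (<-asym i<j j<i)
interleaved⇒cross i<j k<l (inj₂ (inj₁ (i<l , l<j) , inj₂ (inj₂ (k<i , _)))) = inj₂ (k<i , i<l , l<j)
interleaved⇒cross i<j k<l (inj₂ (inj₁ (_ , l<j) , inj₁ (_ , j<k))) = ⊥-elim (<-asym (<-trans k<l l<j) j<k)
interleaved⇒cross i<j k<l (inj₂ (inj₁ (_ , l<j) , inj₂ (inj₁ (j<k , _)))) = ⊥-elim (<-asym (<-trans k<l l<j) j<k)
interleaved⇒cross i<j k<l (inj₂ (inj₂ (inj₁ (_ , j<i)) , _)) = ⊥-elim (<-asym i<j j<i)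
interleaved⇒cross i<j k<l (inj₂ (inj₂ (inj₂ (j<i , _)) , _)) = ⊥-elim (<-asym i<j j<i)

seg-endpoint : ∀ {x y z} → proj₁ (seg x y) ≡ z ⊎ proj₂ (seg x y) ≡ z → x ≡ z ⊎ y ≡ z
seg-endpoint {x} {y} (inj₁ x⊓y≡z) with ⊓-sel x y
... | inj₁ x⊓y≡x = inj₁ (trans (sym x⊓y≡x) x⊓y≡z)
... | inj₂ x⊓y≡y = inj₂ (trans (sym x⊓y≡y) x⊓y≡z)
seg-endpoint {x} {y} (inj₂ x⊔y≡z) with ⊔-sel x y
... | inj₁ x⊔y≡x = inj₁ (trans (sym x⊔y≡x) x⊔y≡z)
... | inj₂ x⊔y≡y = inj₂ (trans (sym x⊔y≡y) x⊔y≡z)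

SegView : ℕ → ℕ → Set
SegView x y = (seg x y ≡ (x , y) × x < y) ⊎ (seg x y ≡ (y , x) × y < x)

seg-comm : ∀ x y → seg x y ≡ seg y x
seg-comm x y = cong₂ _,_ (⊓-comm x y) (⊔-comm x y)

seg-< : ∀ {x y} → x < y → seg x y ≡ (x , y)
seg-< x<y = cong₂ _,_ (m≤n⇒m⊓n≡m (<⇒≤ x<y)) (m≤n⇒m⊔n≡n (<⇒≤ x<y))

segView : ∀ x y → x ≢ y → SegView x y
segView x y x≢y with <-cmp x y
... | tri< x<y _ _ = inj₁ (seg-< x<y , x<y)
... | tri≈ _ x≡y _ = ⊥-elim (x≢y x≡y)
... | tri> _ _ y<x = inj₂ (trans (seg-comm x y) (seg-< y<x) , y<x)

seg-injective : ∀ {x y z w} → x ≢ y → z ≢ w → seg x y ≡ seg z w → (x ≡ z × y ≡ w) ⊎ (x ≡ w × y ≡ z)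
seg-injective {x} {y} {z} {w} x≢y z≢w eq with segView x y x≢y | segView z w z≢w
... | inj₁ (e₁ , _) | inj₁ (e₂ , _) = inj₁ (,-injective (trans (sym e₁) (trans eq e₂)))
... | inj₁ (e₁ , _) | inj₂ (e₂ , _) = inj₂ (,-injective (trans (sym e₁) (trans eq e₂)))
... | inj₂ (e₁ , _) | inj₁ (e₂ , _) = inj₂ (swap (,-injective (trans (sym e₁) (trans eq e₂))))
... | inj₂ (e₁ , _) | inj₂ (e₂ , _) = inj₁ (swap (,-injective (trans (sym e₁) (trans eq e₂))))

seg-cross⇒interleaved : ∀ {x y z w} → x ≢ y → z ≢ w → Cross (seg x y) (seg z w) → Interleaved x y z w
seg-cross⇒interleaved {x} {y} {z} {w} x≢y z≢w c with segView x y x≢y | segView z w z≢w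
... | inj₁ (e₁ , x<y) | inj₁ (e₂ , z<w) = cross⇒interleaved x<y z<w (subst₂ Cross e₁ e₂ c)
... | inj₁ (e₁ , x<y) | inj₂ (e₂ , w<z) = interleaved-swapʳ (cross⇒interleaved x<y w<z (subst₂ Cross e₁ e₂ c))
... | inj₂ (e₁ , y<x) | inj₁ (e₂ , z<w) = interleaved-swapˡ (cross⇒interleaved y<x z<w (subst₂ Cross e₁ e₂ c))
... | inj₂ (e₁ , y<x) | inj₂ (e₂ , w<z) =
  interleaved-swapˡ (interleaved-swapʳ (cross⇒interleaved y<x w<z (subst₂ Cross e₁ e₂ c)))

interleaved⇒seg-cross : ∀ {x y z w} → x ≢ y → z ≢ w → Interleaved x y z w → Cross (seg x y) (seg z w)
interleaved⇒seg-cross {x} {y} {z} {w} x≢y z≢w c with segView x y x≢y | segView z w z≢w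
... | inj₁ (e₁ , x<y) | inj₁ (e₂ , z<w) = subst₂ Cross (sym e₁) (sym e₂) (interleaved⇒cross x<y z<w c)
... | inj₁ (e₁ , x<y) | inj₂ (e₂ , w<z) =
  subst₂ Cross (sym e₁) (sym e₂) (interleaved⇒cross x<y w<z (interleaved-swapʳ c))
... | inj₂ (e₁ , y<x) | inj₁ (e₂ , z<w) =
  subst₂ Cross (sym e₁) (sym e₂) (interleaved⇒cross y<x z<w (interleaved-swapˡ c))
... | inj₂ (e₁ , y<x) | inj₂ (e₂ , w<z) =
  subst₂ Cross (sym e₁) (sym e₂) (interleaved⇒cross y<x w<z (interleaved-swapʳ (interleaved-swapˡ c)))

Side-sym : ∀ {n U x y} → Side n U x y → Side n U y x
Side-sym (inj₁ xy) = inj₂ (inj₁ xy)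
Side-sym (inj₂ (inj₁ yx)) = inj₁ yx
Side-sym (inj₂ (inj₂ (inj₁ xy∈U))) = inj₂ (inj₂ (inj₂ xy∈U))
Side-sym (inj₂ (inj₂ (inj₂ yx∈U))) = inj₂ (inj₂ (inj₁ yx∈U))

triangle-seg : ∀ {n U x y z} → x ≢ y → IsTriangle n U x y z →
               IsTriangle n U (proj₁ (seg x y)) (proj₂ (seg x y)) z
triangle-seg {n} {U} {x} {y} {z} x≢y xyz with segView x y x≢y
... | inj₁ (e , _) = subst (λ s → IsTriangle n U (proj₁ s) (proj₂ s) z) (sym e) xyz
... | inj₂ (e , _) = subst (λ s → IsTriangle n U (proj₁ s) (proj₂ s) z) (sym e) yxz
  where
  yxz : IsTriangle n U y x z
  yxz = let (x<n , y<n , z<n , xy , yz , xz) = xyz in y<n , x<n , z<n , Side-sym xy , xz , yz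

_≟ˢ_ : DecidableEquality Seg
_≟ˢ_ = ≡-dec _≟_ _≟_

open import Data.List.Membership.DecPropositional _≟ˢ_ using (_∈?_)

removeSeg : Seg → List Seg → List Seg
removeSeg e = filter (λ x → ¬? (x ≟ˢ e))

∈-flipped : ∀ {x s e U} → x ∈ s ∷ removeSeg e U ⇔ (x ≡ s ⊎ (x ∈ U × x ≢ e))
∈-flipped {x} {s} {e} {U} = mk⇔ to from
  where
  to : x ∈ s ∷ removeSeg e U → x ≡ s ⊎ (x ∈ U × x ≢ e)
  to (here x≡s) = inj₁ x≡s
  to (there x∈U-e) = inj₂ (∈-filter⁻ (λ y → ¬? (y ≟ˢ e)) x∈U-e)
  from : x ≡ s ⊎ (x ∈ U × x ≢ e) → x ∈ s ∷ removeSeg e U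
  from (inj₁ x≡s) = here x≡s
  from (inj₂ (x∈U , x≢e)) = there (∈-filter⁺ (λ y → ¬? (y ≟ˢ e)) x∈U x≢e)

flip-intro : ∀ {n U a b c d} → (a , b) ∈ U → c ≢ d → IsTriangle n U a b c → IsTriangle n U a b d →
             Flip n U (a , b) (seg c d ∷ removeSeg (a , b) U)
flip-intro ab∈U c≢d abc abd = ab∈U , _ , _ , c≢d , abc , abd , λ x → ∈-flipped

-- The polygon relabelled from v

module Polygon (n : ℕ) where

  next : ℕ → ℕ
  next x with suc x ≟ n
  ... | yes _ = 0
  ... | no _ = suc x

  next-suc : ∀ {x} → suc x < n → next x ≡ suc x
  next-suc {x} sx<n with suc x ≟ n
  ... | yes sx≡n = ⊥-elim (<-irrefl sx≡n sx<n)
  ... | no _ = refl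

  next-last : ∀ {x} → suc x ≡ n → next x ≡ 0
  next-last {x} sx≡n with suc x ≟ n
  ... | yes _ = refl
  ... | no sx≢n = ⊥-elim (sx≢n sx≡n)

  next<n : ∀ {x} → x < n → next x < n
  next<n x<n with m≤n⇒m<n∨m≡n x<n
  ... | inj₁ sx<n rewrite next-suc sx<n = sx<n
  ... | inj₂ sx≡n rewrite next-last sx≡n = ≤-<-trans z≤n x<n

  next-injective : ∀ {x y} → x < n → y < n → next x ≡ next y → x ≡ y
  next-injective x<n y<n eq with m≤n⇒m<n∨m≡n x<n | m≤n⇒m<n∨m≡n y<n
  ... | inj₁ sx<n | inj₁ sy<n rewrite next-suc sx<n | next-suc sy<n = suc-injective eq
  ... | inj₂ sx≡n | inj₂ sy≡n = suc-injective (trans sx≡n (sym sy≡n))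
  ... | inj₁ sx<n | inj₂ sy≡n rewrite next-suc sx<n | next-last sy≡n = ⊥-elim (1+n≢0 eq)
  ... | inj₂ sx≡n | inj₁ sy<n rewrite next-last sx≡n | next-suc sy<n = ⊥-elim (1+n≢0 (sym eq))

  next-surjective : ∀ {y} → y < n → ∃[ x ] (x < n × next x ≡ y)
  next-surjective {zero} 0<n = pred n , subst (pred n <_) n-1+1≡n (n<1+n (pred n)) , next-last n-1+1≡n
    where
    n-1+1≡n : suc (pred n) ≡ n
    n-1+1≡n = suc-pred n {{>-nonZero 0<n}}
  next-surjective {suc y} sy<n = y , <-trans (n<1+n y) sy<n , next-suc sy<n

  next-cyclic-sorted : ∀ {a b c} → a < b → b < c → c < n → Cyclic (next a) (next b) (next c)
  next-cyclic-sorted a<b b<c c<n with m≤n⇒m<n∨m≡n c<n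
  ... | inj₁ sc<n rewrite next-suc (≤-<-trans a<b (<-trans b<c c<n)) | next-suc (≤-<-trans b<c c<n)
                        | next-suc sc<n = inj₁ (s≤s a<b , s≤s b<c)
  ... | inj₂ sc≡n rewrite next-suc (≤-<-trans a<b (<-trans b<c c<n)) | next-suc (≤-<-trans b<c c<n)
                        | next-last sc≡n = inj₂ (inj₂ (s≤s z≤n , s≤s a<b))

  next-cyclic : ∀ {a b c} → a < n → b < n → c < n → Cyclic a b c → Cyclic (next a) (next b) (next c)
  next-cyclic a<n b<n c<n (inj₁ (a<b , b<c)) = next-cyclic-sorted a<b b<c c<n
  next-cyclic a<n b<n c<n (inj₂ (inj₁ (b<c , c<a))) =
    cyclic-rotate (cyclic-rotate (next-cyclic-sorted b<c c<a a<n))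
  next-cyclic a<n b<n c<n (inj₂ (inj₂ (c<a , a<b))) = cyclic-rotate (next-cyclic-sorted c<a a<b b<n)

  Adjacent : ℕ → ℕ → Set
  Adjacent x y = BoundaryEdge n x y ⊎ BoundaryEdge n y x

  adjacent-sym : ∀ {x y} → Adjacent x y → Adjacent y x
  adjacent-sym (inj₁ xy) = inj₂ xy
  adjacent-sym (inj₂ yx) = inj₁ yx

  next⇒adjacent : ∀ {x y} → x < n → y ≡ next x → Adjacent x y
  next⇒adjacent x<n refl with m≤n⇒m<n∨m≡n x<n
  ... | inj₁ sx<n = inj₁ (inj₁ (next-suc sx<n))
  ... | inj₂ sx≡n = inj₂ (inj₂ (next-last sx≡n , sx≡n))

  boundaryEdge⇒next : ∀ {x y} → x < n → y < n → BoundaryEdge n x y → y ≡ next x ⊎ x ≡ next y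
  boundaryEdge⇒next x<n y<n (inj₁ refl) = inj₁ (sym (next-suc y<n))
  boundaryEdge⇒next x<n y<n (inj₂ (refl , sy≡n)) = inj₂ (sym (next-last sy≡n))

  adjacent⇒next : ∀ {x y} → x < n → y < n → Adjacent x y → y ≡ next x ⊎ x ≡ next y
  adjacent⇒next x<n y<n (inj₁ xy) = boundaryEdge⇒next x<n y<n xy
  adjacent⇒next x<n y<n (inj₂ yx) = Sum.swap (boundaryEdge⇒next y<n x<n yx)

  rotate : ℕ → ℕ → ℕ
  rotate zero x = x
  rotate (suc k) x = next (rotate k x)

  rotate<n : ∀ k {x} → x < n → rotate k x < n
  rotate<n zero x<n = x<n
  rotate<n (suc k) x<n = next<n (rotate<n k x<n)

  rotate-injective : ∀ k {x y} → x < n → y < n → rotate k x ≡ rotate k y → x ≡ y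
  rotate-injective zero x<n y<n eq = eq
  rotate-injective (suc k) x<n y<n eq =
    rotate-injective k x<n y<n (next-injective (rotate<n k x<n) (rotate<n k y<n) eq)

  rotate-surjective : ∀ k {y} → y < n → ∃[ x ] (x < n × rotate k x ≡ y)
  rotate-surjective zero {y} y<n = y , y<n , refl
  rotate-surjective (suc k) y<n with next-surjective y<n
  ... | z , z<n , refl with rotate-surjective k z<n
  ... | x , x<n , refl = x , x<n , refl

  rotate-next : ∀ k x → rotate k (next x) ≡ next (rotate k x)
  rotate-next zero x = refl
  rotate-next (suc k) x = cong next (rotate-next k x)

  rotate-0 : ∀ k → k < n → rotate k 0 ≡ k
  rotate-0 zero _ = refl
  rotate-0 (suc k) sk<n = trans (cong next (rotate-0 k (<-trans (n<1+n k) sk<n))) (next-suc sk<n)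

  rotate-cyclic : ∀ k {a b c} → a < n → b < n → c < n → Cyclic a b c →
                  Cyclic (rotate k a) (rotate k b) (rotate k c)
  rotate-cyclic zero a<n b<n c<n abc = abc
  rotate-cyclic (suc k) a<n b<n c<n abc =
    next-cyclic (rotate<n k a<n) (rotate<n k b<n) (rotate<n k c<n) (rotate-cyclic k a<n b<n c<n abc)

  rotate-cyclic⁻ : ∀ k {a b c} → a < n → b < n → c < n →
                   Cyclic (rotate k a) (rotate k b) (rotate k c) → Cyclic a b c
  rotate-cyclic⁻ k {a} {b} {c} a<n b<n c<n abc
    with cyclic-total a b c (λ a≡b → cyclic⇒≢ abc (cong (rotate k) a≡b))
                            (λ b≡c → cyclic⇒≢ (cyclic-rotate abc) (cong (rotate k) b≡c))
                            (λ a≡c → cyclic⇒≢ (cyclic-rotate (cyclic-rotate abc)) (cong (rotate k) (sym a≡c)))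
  ... | inj₁ abc⁻ = abc⁻
  ... | inj₂ acb⁻ = ⊥-elim (cyclic-asym abc (rotate-cyclic k a<n c<n b<n acb⁻))

  rotate-adjacent : ∀ k {x y} → x < n → y < n → Adjacent x y → Adjacent (rotate k x) (rotate k y)
  rotate-adjacent k {x} {y} x<n y<n xy with adjacent⇒next x<n y<n xy
  ... | inj₁ refl = next⇒adjacent (rotate<n k x<n) (rotate-next k x)
  ... | inj₂ refl = adjacent-sym (next⇒adjacent (rotate<n k y<n) (rotate-next k y))

  rotate-adjacent⁻ : ∀ k {x y} → x < n → y < n → Adjacent (rotate k x) (rotate k y) → Adjacent x y
  rotate-adjacent⁻ k {x} {y} x<n y<n xy with adjacent⇒next (rotate<n k x<n) (rotate<n k y<n) xy
  ... | inj₁ eq = next⇒adjacent x<n (rotate-injective k y<n (next<n x<n) (trans eq (sym (rotate-next k x))))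
  ... | inj₂ eq =
    adjacent-sym (next⇒adjacent y<n (rotate-injective k x<n (next<n y<n) (trans eq (sym (rotate-next k y)))))

  adjacent-sorted : ∀ {x y} → x < y → y < n → Adjacent x y → BoundaryEdge n x y
  adjacent-sorted x<y y<n (inj₁ xy) = xy
  adjacent-sorted x<y y<n (inj₂ (inj₁ refl)) = ⊥-elim (<-asym x<y (n<1+n _))
  adjacent-sorted x<y y<n (inj₂ (inj₂ (refl , sx≡n))) = ⊥-elim (<-irrefl sx≡n (≤-<-trans x<y y<n))

  seg-diagonal⇒¬adjacent : ∀ {x y} → x ≢ y → Diagonal n (seg x y) → ¬ Adjacent x y
  seg-diagonal⇒¬adjacent {x} {y} x≢y d xy with segView x y x≢y
  ... | inj₁ (e , x<y) = let (_ , y<n , ¬xy) = subst (Diagonal n) e d in ¬xy (adjacent-sorted x<y y<n xy)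
  ... | inj₂ (e , y<x) = let (_ , x<n , ¬yx) = subst (Diagonal n) e d in ¬yx (adjacent-sorted y<x x<n (adjacent-sym xy))

  ¬adjacent⇒seg-diagonal : ∀ {x y} → x < n → y < n → x ≢ y → ¬ Adjacent x y → Diagonal n (seg x y)
  ¬adjacent⇒seg-diagonal {x} {y} x<n y<n x≢y ¬xy with segView x y x≢y
  ... | inj₁ (e , x<y) = subst (Diagonal n) (sym e) (x<y , y<n , λ xy → ¬xy (inj₁ xy))
  ... | inj₂ (e , y<x) = subst (Diagonal n) (sym e) (y<x , x<n , λ yx → ¬xy (inj₂ yx))

  boundaryEdge-¬cross : ∀ {p q a b} → q < n → BoundaryEdge n a b → ¬ Cross (p , q) (a , b)
  boundaryEdge-¬cross q<n (inj₁ refl) (inj₁ (_ , a<q , q<b)) = <-irrefl refl (<-≤-trans a<q (≤-pred q<b))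
  boundaryEdge-¬cross q<n (inj₁ refl) (inj₂ (a<p , p<b , _)) = <-irrefl refl (<-≤-trans a<p (≤-pred p<b))
  boundaryEdge-¬cross q<n (inj₂ (refl , _)) (inj₁ (() , _))
  boundaryEdge-¬cross q<n (inj₂ (refl , sb≡n)) (inj₂ (_ , _ , b<q)) = <-irrefl sb≡n (≤-<-trans b<q q<n)

  adjacent-suc : ∀ p → Adjacent p (suc p)
  adjacent-suc p = inj₁ (inj₁ refl)

  adjacent-last : ∀ {q} → suc q ≡ n → Adjacent q 0
  adjacent-last sq≡n = inj₂ (inj₂ (refl , sq≡n))

  adjacent⇒suc : ∀ {p q} → 1 ≤ p → p < q → q < n → Adjacent p q → q ≡ suc p
  adjacent⇒suc 1≤p p<q q<n pq with adjacent-sorted p<q q<n pq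
  ... | inj₁ q≡sp = q≡sp
  ... | inj₂ (refl , _) = ⊥-elim (<-irrefl refl 1≤p)

  adjacent-of-boundaryEdges : ∀ {x y z} →
    BoundaryEdge n x y ⊎ BoundaryEdge n y x ⊎ BoundaryEdge n y z ⊎
    BoundaryEdge n z y ⊎ BoundaryEdge n x z ⊎ BoundaryEdge n z x →
    Adjacent x y ⊎ Adjacent y z ⊎ Adjacent x z
  adjacent-of-boundaryEdges (inj₁ xy) = inj₁ (inj₁ xy)
  adjacent-of-boundaryEdges (inj₂ (inj₁ yx)) = inj₁ (inj₂ yx)
  adjacent-of-boundaryEdges (inj₂ (inj₂ (inj₁ yz))) = inj₂ (inj₁ (inj₁ yz))
  adjacent-of-boundaryEdges (inj₂ (inj₂ (inj₂ (inj₁ zy)))) = inj₂ (inj₁ (inj₂ zy))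
  adjacent-of-boundaryEdges (inj₂ (inj₂ (inj₂ (inj₂ (inj₁ xz))))) = inj₂ (inj₂ (inj₁ xz))
  adjacent-of-boundaryEdges (inj₂ (inj₂ (inj₂ (inj₂ (inj₂ zx))))) = inj₂ (inj₂ (inj₂ zx))

module Rotated (n v : ℕ) (v<n : v < n) where
  open Polygon n public

  -- vertex p is the p-th vertex after v, so v itself is vertex 0.
  vertex : ℕ → ℕ
  vertex = rotate v

  chord : ℕ → ℕ → Seg
  chord p q = seg (vertex p) (vertex q)

  0<n : 0 < n
  0<n = ≤-<-trans z≤n v<n

  vertex<n : ∀ {p} → p < n → vertex p < n
  vertex<n = rotate<n v

  vertex-0 : vertex 0 ≡ v
  vertex-0 = rotate-0 v v<n

  vertex-injective : ∀ {p q} → p < n → q < n → vertex p ≡ vertex q → p ≡ q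
  vertex-injective = rotate-injective v

  vertex-≢ : ∀ {p q} → p < n → q < n → p ≢ q → vertex p ≢ vertex q
  vertex-≢ p<n q<n p≢q eq = p≢q (vertex-injective p<n q<n eq)

  vertex-interleaved : ∀ {i j k l} → i < n → j < n → k < n → l < n →
                       Interleaved i j k l → Interleaved (vertex i) (vertex j) (vertex k) (vertex l)
  vertex-interleaved i<n j<n k<n l<n (inj₁ (ikj , ijl)) =
    inj₁ (rotate-cyclic v i<n k<n j<n ikj , rotate-cyclic v i<n j<n l<n ijl)
  vertex-interleaved i<n j<n k<n l<n (inj₂ (ilj , ijk)) =
    inj₂ (rotate-cyclic v i<n l<n j<n ilj , rotate-cyclic v i<n j<n k<n ijk)

  vertex-interleaved⁻ : ∀ {i j k l} → i < n → j < n → k < n → l < n →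
                        Interleaved (vertex i) (vertex j) (vertex k) (vertex l) → Interleaved i j k l
  vertex-interleaved⁻ i<n j<n k<n l<n (inj₁ (ikj , ijl)) =
    inj₁ (rotate-cyclic⁻ v i<n k<n j<n ikj , rotate-cyclic⁻ v i<n j<n l<n ijl)
  vertex-interleaved⁻ i<n j<n k<n l<n (inj₂ (ilj , ijk)) =
    inj₂ (rotate-cyclic⁻ v i<n l<n j<n ilj , rotate-cyclic⁻ v i<n j<n k<n ijk)

  chord-cross : ∀ {p q p′ q′} → p < q → q < n → p′ < q′ → q′ < n →
                Cross (p , q) (p′ , q′) → Cross (chord p q) (chord p′ q′)
  chord-cross {p} {q} {p′} {q′} p<q q<n p′<q′ q′<n c =
    interleaved⇒seg-cross (vertex-≢ p<n q<n (<⇒≢ p<q)) (vertex-≢ p′<n q′<n (<⇒≢ p′<q′))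
      (vertex-interleaved p<n q<n p′<n q′<n (cross⇒interleaved p<q p′<q′ c))
    where
    p<n : p < n
    p<n = <-trans p<q q<n
    p′<n : p′ < n
    p′<n = <-trans p′<q′ q′<n

  chord-cross⁻ : ∀ {p q p′ q′} → p < q → q < n → p′ < q′ → q′ < n →
                 Cross (chord p q) (chord p′ q′) → Cross (p , q) (p′ , q′)
  chord-cross⁻ {p} {q} {p′} {q′} p<q q<n p′<q′ q′<n c =
    interleaved⇒cross p<q p′<q′ (vertex-interleaved⁻ p<n q<n p′<n q′<n
      (seg-cross⇒interleaved (vertex-≢ p<n q<n (<⇒≢ p<q)) (vertex-≢ p′<n q′<n (<⇒≢ p′<q′)) c))
    where
    p<n : p < n
    p<n = <-trans p<q q<n
    p′<n : p′ < n
    p′<n = <-trans p′<q′ q′<n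

  chord-injective : ∀ {p q p′ q′} → p < q → q < n → p′ < q′ → q′ < n →
                    chord p q ≡ chord p′ q′ → p ≡ p′ × q ≡ q′
  chord-injective {p} {q} {p′} {q′} p<q q<n p′<q′ q′<n eq =
    endpoints (seg-injective (vertex-≢ p<n q<n (<⇒≢ p<q)) (vertex-≢ p′<n q′<n (<⇒≢ p′<q′)) eq)
    where
    p<n : p < n
    p<n = <-trans p<q q<n
    p′<n : p′ < n
    p′<n = <-trans p′<q′ q′<n
    endpoints : (vertex p ≡ vertex p′ × vertex q ≡ vertex q′) ⊎ (vertex p ≡ vertex q′ × vertex q ≡ vertex p′) →
                p ≡ p′ × q ≡ q′
    endpoints (inj₁ (p≡p′ , q≡q′)) = vertex-injective p<n p′<n p≡p′ , vertex-injective q<n q′<n q≡q′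
    endpoints (inj₂ (p≡q′ , q≡p′)) with vertex-injective p<n q′<n p≡q′ | vertex-injective q<n p′<n q≡p′
    ... | refl | refl = ⊥-elim (<-asym p<q p′<q′)

  chord-surjective : ∀ {i j} → i < j → j < n → ∃[ p ] ∃[ q ] (p < q × q < n × (i , j) ≡ chord p q)
  chord-surjective {i} {j} i<j j<n with rotate-surjective v (<-trans i<j j<n) | rotate-surjective v j<n
  ... | a , a<n , refl | b , b<n , refl with <-cmp a b
  ... | tri< a<b _ _ = a , b , a<b , b<n , sym (seg-< i<j)
  ... | tri≈ _ refl _ = ⊥-elim (<-irrefl refl i<j)
  ... | tri> _ _ b<a = b , a , b<a , a<n , trans (sym (seg-< i<j)) (seg-comm (vertex a) (vertex b))

  chord-comm : ∀ p q → chord p q ≡ chord q p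
  chord-comm p q = seg-comm (vertex p) (vertex q)

  vertex-adjacent : ∀ {p q} → p < n → q < n → Adjacent p q → Adjacent (vertex p) (vertex q)
  vertex-adjacent = rotate-adjacent v

  vertex-adjacent⁻ : ∀ {p q} → p < n → q < n → Adjacent (vertex p) (vertex q) → Adjacent p q
  vertex-adjacent⁻ = rotate-adjacent⁻ v

  ¬adjacent⇒chord-diagonal : ∀ {p q} → p < q → q < n → ¬ Adjacent p q → Diagonal n (chord p q)
  ¬adjacent⇒chord-diagonal {p} p<q q<n ¬pq =
    ¬adjacent⇒seg-diagonal (vertex<n p<n) (vertex<n q<n) (vertex-≢ p<n q<n (<⇒≢ p<q))
      (λ pq → ¬pq (vertex-adjacent⁻ p<n q<n pq))
    where
    p<n : p < n
    p<n = <-trans p<q q<n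

  SideIn : List Seg → ℕ → ℕ → Set
  SideIn U p q = Adjacent p q ⊎ chord p q ∈ U

  sideIn⇒Side : ∀ {U p q} → p < n → q < n → p ≢ q → SideIn U p q → Side n U (vertex p) (vertex q)
  sideIn⇒Side p<n q<n p≢q (inj₁ pq) with vertex-adjacent p<n q<n pq
  ... | inj₁ e = inj₁ e
  ... | inj₂ e = inj₂ (inj₁ e)
  sideIn⇒Side {U} {p} {q} p<n q<n p≢q (inj₂ pq∈U) with segView (vertex p) (vertex q) (vertex-≢ p<n q<n p≢q)
  ... | inj₁ (e , _) = inj₂ (inj₂ (inj₁ (subst (_∈ U) e pq∈U)))
  ... | inj₂ (e , _) = inj₂ (inj₂ (inj₂ (subst (_∈ U) e pq∈U)))

  InFan : ℕ → Set
  InFan y = 2 ≤ y × suc y < n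

  FanChord : Seg → Set
  FanChord x = ∃[ y ] (InFan y × x ≡ chord 0 y)

  ¬adjacent⇒inFan : ∀ {q} → 0 < q → q < n → ¬ Adjacent 0 q → InFan q
  ¬adjacent⇒inFan 0<q q<n ¬0q =
    ≤∧≢⇒< 0<q (λ 1≡q → ¬0q (subst (Adjacent 0) 1≡q (adjacent-suc 0))) ,
    ≤∧≢⇒< q<n (λ sq≡n → ¬0q (adjacent-sym (adjacent-last sq≡n)))

  sideIn-sym : ∀ {U p q} → SideIn U p q → SideIn U q p
  sideIn-sym (inj₁ pq) = inj₁ (adjacent-sym pq)
  sideIn-sym {U} {p} {q} (inj₂ pq∈U) = inj₂ (subst (_∈ U) (chord-comm p q) pq∈U)

  sideIn-long : ∀ {U p q} → 1 ≤ p → suc p < q → q < n → SideIn U p q → chord p q ∈ U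
  sideIn-long 1≤p sp<q q<n (inj₁ pq) = ⊥-elim (<-irrefl (sym (adjacent⇒suc 1≤p (<-trans (n<1+n _) sp<q) q<n pq)) sp<q)
  sideIn-long _ _ _ (inj₂ pq∈U) = pq∈U

  triangle : ∀ {U a b c} → a < n → b < n → c < n → a ≢ b → b ≢ c → a ≢ c →
             SideIn U a b → SideIn U b c → SideIn U a c → IsTriangle n U (vertex a) (vertex b) (vertex c)
  triangle a<n b<n c<n a≢b b≢c a≢c ab bc ac =
    vertex<n a<n , vertex<n b<n , vertex<n c<n ,
    sideIn⇒Side a<n b<n a≢b ab , sideIn⇒Side b<n c<n b≢c bc , sideIn⇒Side a<n c<n a≢c ac

module InTriangulation (n v : ℕ) (v<n : v < n) {X : List Seg} (tri : Triangulation n X) where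
  open Rotated n v v<n
  open Triangulation tri

  chord-of : ∀ {e} → e ∈ X → ∃[ p ] ∃[ q ] (p < q × q < n × e ≡ chord p q)
  chord-of e∈X with All.lookup diagonals e∈X
  ... | i<j , j<n , _ = chord-surjective i<j j<n

  chord∈⇒¬adjacent : ∀ {p q} → p < q → q < n → chord p q ∈ X → ¬ Adjacent p q
  chord∈⇒¬adjacent {p} p<q q<n pq∈X pq =
    seg-diagonal⇒¬adjacent (vertex-≢ p<n q<n (<⇒≢ p<q)) (All.lookup diagonals pq∈X) (vertex-adjacent p<n q<n pq)
    where
    p<n : p < n
    p<n = <-trans p<q q<n

  chord∈⇒suc< : ∀ {p q} → p < q → q < n → chord p q ∈ X → suc p < q
  chord∈⇒suc< p<q q<n pq∈X = ≤∧≢⇒< p<q (λ sp≡q → chord∈⇒¬adjacent p<q q<n pq∈X (subst (Adjacent _) sp≡q (adjacent-suc _)))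

  chord-noncrossing : ∀ {p q p′ q′} → p < q → q < n → p′ < q′ → q′ < n →
                      chord p q ∈ X → chord p′ q′ ∈ X → ¬ Cross (p , q) (p′ , q′)
  chord-noncrossing p<q q<n p′<q′ q′<n pq∈X p′q′∈X c = nonCrossing pq∈X p′q′∈X (chord-cross p<q q<n p′<q′ q′<n c)

  side-noncrossing : ∀ {p q a b} → p < q → q < n → a < b → b < n →
                     chord p q ∈ X → SideIn X a b → ¬ Cross (p , q) (a , b)
  side-noncrossing p<q q<n a<b b<n pq∈X (inj₁ ab) = boundaryEdge-¬cross q<n (adjacent-sorted a<b b<n ab)
  side-noncrossing p<q q<n a<b b<n pq∈X (inj₂ ab∈X) = chord-noncrossing p<q q<n a<b b<n pq∈X ab∈X

  chord∉⇒crossed : ∀ {p q} → p < q → q < n → ¬ Adjacent p q → ¬ chord p q ∈ X →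
                   ∃[ p′ ] ∃[ q′ ] (p′ < q′ × q′ < n × chord p′ q′ ∈ X × Cross (p , q) (p′ , q′))
  chord∉⇒crossed p<q q<n ¬pq pq∉X with find (maximal _ (¬adjacent⇒chord-diagonal p<q q<n ¬pq) pq∉X)
  ... | e , e∈X , c with chord-of e∈X
  ... | p′ , q′ , p′<q′ , q′<n , refl = p′ , q′ , p′<q′ , q′<n , e∈X , chord-cross⁻ p<q q<n p′<q′ q′<n c

-- A star is the fan at its centre

module StarIsFan (n v : ℕ) (v<n : v < n) {S : List Seg} (tri : Triangulation n S) (deg : degree S v ≡ n ∸ 1) where
  open Rotated n v v<n
  open InTriangulation n v v<n tri
  open Triangulation tri

  incident⇒fanChord : ∀ {e} → e ∈ S → proj₁ e ≡ v ⊎ proj₂ e ≡ v → FanChord e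
  incident⇒fanChord e∈S incident with chord-of e∈S
  ... | p , q , p<q , q<n , refl with seg-endpoint incident
  ...   | inj₂ q≡v = ⊥-elim (<-irrefl (sym (vertex-injective q<n 0<n (trans q≡v (sym vertex-0)))) (≤-<-trans z≤n p<q))
  ...   | inj₁ p≡v with vertex-injective (<-trans p<q q<n) 0<n (trans p≡v (sym vertex-0))
  ...     | refl = q , ¬adjacent⇒inFan p<q q<n (chord∈⇒¬adjacent p<q q<n e∈S) , refl

  fanList : List Seg
  fanList = applyUpTo (λ i → chord 0 (2 + i)) (n ∸ 3)

  inFan⇒∈fanList : ∀ {y} → InFan y → chord 0 y ∈ fanList
  inFan⇒∈fanList {y} (2≤y , sy<n) = subst (λ z → chord 0 z ∈ fanList) (m+[n∸m]≡n 2≤y)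
    (∈-applyUpTo⁺ (λ i → chord 0 (2 + i)) (∸-monoˡ-< {m = suc y} {n = 3} sy<n (s≤s 2≤y)))

  incidents : List Seg
  incidents = filter (incident? v) S

  length-incidents : length incidents ≡ n ∸ 3
  length-incidents = trans (cong (_∸ 2) deg) (∸-+-assoc n 1 2)

  -- The n - 3 diagonals of S at v are distinct fan chords, and there are only n - 3 of those.
  inFan⇒∈star : ∀ {y} → InFan y → chord 0 y ∈ S
  inFan⇒∈star {y} y∈fan with chord 0 y ∈? S
  ... | yes y∈S = y∈S
  ... | no y∉S = ⊥-elim (1+n≰n (subst₂ _≤_ (cong suc length-incidents) (length-applyUpTo _ (n ∸ 3)) too-many))
    where
    y∷incidents! : Unique (chord 0 y ∷ incidents)
    y∷incidents! = All.tabulate (λ e∈inc y≡e → y∉S (subst (_∈ S) (sym y≡e) (proj₁ (∈-filter⁻ (incident? v) e∈inc))))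
                 ∷ Unique.filter⁺ (incident? v) noDup
    ⊆fanList : ∀ {e} → e ∈ chord 0 y ∷ incidents → e ∈ fanList
    ⊆fanList (here refl) = inFan⇒∈fanList y∈fan
    ⊆fanList (there e∈inc) with ∈-filter⁻ (incident? v) e∈inc
    ... | e∈S , incident with incident⇒fanChord e∈S incident
    ...   | z , z∈fan , refl = inFan⇒∈fanList z∈fan
    too-many : suc (length incidents) ≤ length fanList
    too-many = unique∧⊆⇒length≤ _≟ˢ_ y∷incidents! ⊆fanList

  star⇒fanChord : ∀ {e} → e ∈ S → FanChord e
  star⇒fanChord e∈S with chord-of e∈S
  ... | p , q , p<q , q<n , refl with p ≟ 0
  ...   | yes refl = q , ¬adjacent⇒inFan p<q q<n (chord∈⇒¬adjacent p<q q<n e∈S) , refl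
  ...   | no p≢0 = ⊥-elim (chord-noncrossing p<q q<n (s≤s z≤n) (<-trans sp<q q<n) e∈S
                               (inFan⇒∈star (s≤s 0<p , ≤-<-trans sp<q q<n)) (inj₂ (0<p , n<1+n p , sp<q)))
    where
    0<p : 0 < p
    0<p = n≢0⇒n>0 p≢0
    sp<q : suc p < q
    sp<q = chord∈⇒suc< p<q q<n e∈S

  star⇔fanChord : ∀ x → x ∈ S ⇔ FanChord x
  star⇔fanChord x = mk⇔ star⇒fanChord λ { (y , y∈fan , refl) → inFan⇒∈star y∈fan }

-- Flipping a zigzag triangulation into the star

module ZigzagFlips (n v : ℕ) (v<n : v < n) {T : List Seg} (tri : Triangulation n T) (zigzag : Zigzag n T)
                   (endpoint : degree T v ≡ 2) {S : List Seg}
                   (star : ∀ x → x ∈ S ⇔ Rotated.FanChord n v v<n x) where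
  open Rotated n v v<n
  open InTriangulation n v v<n tri
  open Triangulation tri

  ¬chord0∈T : ∀ {q} → 0 < q → q < n → ¬ chord 0 q ∈ T
  ¬chord0∈T {q} 0<q q<n 0q∈T =
    <-irrefl (sym no-incidents) (∈-length (∈-filter⁺ (incident? v) 0q∈T incident))
    where
    no-incidents : length (filter (incident? v) T) ≡ 0
    no-incidents = cong (_∸ 2) endpoint
    incident : proj₁ (chord 0 q) ≡ v ⊎ proj₂ (chord 0 q) ≡ v
    incident with segView (vertex 0) (vertex q) (vertex-≢ 0<n q<n (<⇒≢ 0<q))
    ... | inj₁ (e , _) = inj₁ (trans (cong proj₁ e) vertex-0)
    ... | inj₂ (e , _) = inj₂ (trans (cong proj₂ e) vertex-0)

  Apex : ℕ → ℕ → Set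
  Apex α β = ∃[ w ] (α < w × w < β × SideIn T α w × SideIn T w β)

  -- Move w up to the far end of any diagonal α q of T crossing w β; the fuel f bounds β - w.
  apex-search : ∀ {α β} f w → 1 ≤ α → β < n → chord α β ∈ T →
                β ≤ w + f → α < w → w < β → SideIn T α w → Apex α β
  apex-search zero w _ _ _ β≤w+0 _ w<β _ = ⊥-elim (<⇒≱ w<β (subst (_ ≤_) (+-identityʳ w) β≤w+0))
  apex-search {α} {β} (suc f) w 1≤α β<n αβ∈T β≤w+sf α<w w<β αw with suc w ≟ β
  ... | yes refl = w , α<w , w<β , αw , inj₁ (adjacent-suc w)
  ... | no sw≢β with chord w β ∈? T
  ...   | yes wβ∈T = w , α<w , w<β , αw , inj₂ wβ∈T
  ...   | no wβ∉T with chord∉⇒crossed w<β β<n (λ wβ → sw≢β (sym (adjacent⇒suc (≤-trans 1≤α (<⇒≤ α<w)) w<β β<n wβ))) wβ∉T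
  ...     | p , q , p<q , q<n , pq∈T , inj₁ (w<p , p<β , β<q) =
    ⊥-elim (chord-noncrossing p<q q<n (<-trans α<w w<β) β<n pq∈T αβ∈T (inj₂ (<-trans α<w w<p , p<β , β<q)))
  ...     | p , q , p<q , q<n , pq∈T , inj₂ (p<w , w<q , q<β) with <-cmp p α
  ...       | tri< p<α _ _ =
    ⊥-elim (chord-noncrossing p<q q<n (<-trans α<w w<β) β<n pq∈T αβ∈T (inj₁ (p<α , <-trans α<w w<q , q<β)))
  ...       | tri≈ _ refl _ =
    apex-search f q 1≤α β<n αβ∈T (≤-trans β≤w+sf (≤-trans (≤-reflexive (+-suc w f)) (+-monoˡ-≤ f w<q)))
      (<-trans α<w w<q) q<β (inj₂ pq∈T)
  ...       | tri> _ _ α<p =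
    ⊥-elim (side-noncrossing p<q q<n α<w (<-trans w<β β<n) pq∈T αw (inj₂ (α<p , p<w , w<q)))

  apex : ∀ {α β} → 1 ≤ α → α < β → β < n → chord α β ∈ T → Apex α β
  apex {α} {β} 1≤α α<β β<n αβ∈T =
    apex-search β (suc α) 1≤α β<n αβ∈T (m≤n+m β (suc α)) (n<1+n α) (chord∈⇒suc< α<β β<n αβ∈T) (inj₁ (adjacent-suc α))

  -- The triangle α w β has the polygon side α w or w β, and α′ β′ is its third side.
  data Ear (α β w : ℕ) : ℕ → ℕ → Set where
    left-ear  : w ≡ suc α → Ear α β w w β
    right-ear : β ≡ suc w → Ear α β w α w

  zigzag-ear : ∀ {α w β} → 1 ≤ α → α < w → w < β → β < n → chord α β ∈ T → SideIn T α w → SideIn T w β →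
               ∃[ α′ ] ∃[ β′ ] Ear α β w α′ β′
  zigzag-ear {α} {w} {β} 1≤α α<w w<β β<n αβ∈T αw wβ = ear (adjacent-of-boundaryEdges (zigzag _ _ _ apex-triangle))
    where
    α<β : α < β
    α<β = <-trans α<w w<β
    w<n : w < n
    w<n = <-trans w<β β<n
    α<n : α < n
    α<n = <-trans α<w w<n
    apex-triangle : IsTriangle n T (vertex α) (vertex w) (vertex β)
    apex-triangle = triangle α<n w<n β<n (<⇒≢ α<w) (<⇒≢ w<β) (<⇒≢ α<β) αw wβ (inj₂ αβ∈T)
    ear : Adjacent (vertex α) (vertex w) ⊎ Adjacent (vertex w) (vertex β) ⊎ Adjacent (vertex α) (vertex β) →
          ∃[ α′ ] ∃[ β′ ] Ear α β w α′ β′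
    ear (inj₁ αw-edge) = _ , _ , left-ear (adjacent⇒suc 1≤α α<w w<n (vertex-adjacent⁻ α<n w<n αw-edge))
    ear (inj₂ (inj₁ wβ-edge)) =
      _ , _ , right-ear (adjacent⇒suc (≤-trans 1≤α (<⇒≤ α<w)) w<β β<n (vertex-adjacent⁻ w<n β<n wβ-edge))
    ear (inj₂ (inj₂ αβ-edge)) = ⊥-elim (chord∈⇒¬adjacent α<β β<n αβ∈T (vertex-adjacent⁻ α<n β<n αβ-edge))

  Inside : ℕ → ℕ → Seg → Set
  Inside α β e = ∃[ p ] ∃[ q ] (α ≤ p × p < q × q ≤ β × e ≡ chord p q)

  inside-mono : ∀ {α β α′ β′ e} → α ≤ α′ → β′ ≤ β → Inside α′ β′ e → Inside α β e
  inside-mono α≤α′ β′≤β (p , q , α′≤p , p<q , q≤β′ , e≡pq) = p , q , ≤-trans α≤α′ α′≤p , p<q , ≤-trans q≤β′ β′≤β , e≡pq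

  inside-chord : ∀ {α β p q} → β < n → p < q → q < n → Inside α β (chord p q) → α ≤ p × q ≤ β
  inside-chord β<n p<q q<n (p′ , q′ , α≤p′ , p′<q′ , q′≤β , eq) with chord-injective p<q q<n p′<q′ (≤-<-trans q′≤β β<n) eq
  ... | refl , refl = α≤p′ , q′≤β

  ¬inside-edge : ∀ {α e} → suc α < n → e ∈ T → ¬ Inside α (suc α) e
  ¬inside-edge sα<n e∈T (p , q , α≤p , p<q , q≤sα , refl) =
    chord∈⇒¬adjacent p<q (≤-<-trans q≤sα sα<n) e∈T
      (subst (Adjacent p) (≤-antisym p<q (≤-trans q≤sα (s≤s α≤p))) (adjacent-suc p))

  apex-split : ∀ {α w β e} → α < w → w < β → β < n → SideIn T α w → SideIn T w β →
               e ∈ T → Inside α β e → e ≢ chord α β → Inside α w e ⊎ Inside w β e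
  apex-split {α} {w} {β} α<w w<β β<n αw wβ e∈T (p , q , α≤p , p<q , q≤β , refl) e≢αβ with ≤-<-connex q w | ≤-<-connex w p
  ... | inj₁ q≤w | _ = inj₁ (p , q , α≤p , p<q , q≤w , refl)
  ... | inj₂ _ | inj₁ w≤p = inj₂ (p , q , w≤p , p<q , q≤β , refl)
  ... | inj₂ w<q | inj₂ p<w with m≤n⇒m<n∨m≡n α≤p
  ...   | inj₁ α<p =
    ⊥-elim (side-noncrossing p<q (≤-<-trans q≤β β<n) α<w (<-trans w<β β<n) e∈T αw (inj₂ (α<p , p<w , w<q)))
  ...   | inj₂ refl = ⊥-elim (side-noncrossing p<q (≤-<-trans q≤β β<n) w<β β<n e∈T wβ (inj₁ (p<w , w<q , q<β)))
    where
    q<β : q < β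
    q<β = ≤∧≢⇒< q≤β (λ q≡β → e≢αβ (cong (chord α) q≡β))

  FanOutside : ℕ → ℕ → ℕ → Set
  FanOutside α β y = InFan y × (y ≤ α ⊎ β ≤ y)

  -- The intermediate triangulations: the fan chords 0 y with y outside (α, β), plus the diagonals π still to flip.
  PartialStar : ℕ → ℕ → List Seg → List Seg → Set
  PartialStar α β π U = ∀ x → x ∈ U ⇔ (∃[ y ] (FanOutside α β y × x ≡ chord 0 y) ⊎ x ∈ π)

  ear-bounds : ∀ {α β w α′ β′} → Ear α β w α′ β′ → α ≤ α′ × β′ ≤ β
  ear-bounds (left-ear refl) = n≤1+n _ , ≤-refl
  ear-bounds (right-ear refl) = ≤-refl , n≤1+n _

  ear-shrinks : ∀ {α β w α′ β′} → Ear α β w α′ β′ → α < α′ ⊎ β′ < β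
  ear-shrinks (left-ear refl) = inj₁ (n<1+n _)
  ear-shrinks (right-ear refl) = inj₂ (n<1+n _)

  ear-side : ∀ {U α β w α′ β′} → Ear α β w α′ β′ → SideIn U α w → SideIn U w β → SideIn U α′ β′
  ear-side (left-ear refl) αw wβ = wβ
  ear-side (right-ear refl) αw wβ = αw

  ear-length : ∀ k {α β w α′ β′} → Ear α β w α′ β′ → β ≡ suc (suc k + α) → β′ ≡ suc (k + α′)
  ear-length k {α} (left-ear refl) β≡ = trans β≡ (cong suc (sym (+-suc k α)))
  ear-length k (right-ear refl) β≡ = suc-injective β≡

  ear-narrow : ∀ {α β w α′ β′ e} → Ear α β w α′ β′ → α < w → w < β → β < n → SideIn T α w → SideIn T w β →
               e ∈ T → Inside α β e → e ≢ chord α β → Inside α′ β′ e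
  ear-narrow ear α<w w<β β<n αw wβ e∈T inside e≢αβ with ear | apex-split α<w w<β β<n αw wβ e∈T inside e≢αβ
  ... | left-ear refl | inj₁ in-edge = ⊥-elim (¬inside-edge (<-trans w<β β<n) e∈T in-edge)
  ... | left-ear refl | inj₂ in-rest = in-rest
  ... | right-ear refl | inj₁ in-rest = in-rest
  ... | right-ear refl | inj₂ in-edge = ⊥-elim (¬inside-edge β<n e∈T in-edge)

  ear-fan : ∀ {α β w α′ β′} → Ear α β w α′ β′ → InFan w → ∀ y → FanOutside α′ β′ y ⇔ (y ≡ w ⊎ FanOutside α β y)
  ear-fan {α} {β} (left-ear refl) w∈fan y = mk⇔ to from
    where
    to : FanOutside (suc α) β y → y ≡ suc α ⊎ FanOutside α β y
    to (y∈fan , inj₁ y≤w) with m≤n⇒m<n∨m≡n y≤w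
    ... | inj₁ y<w = inj₂ (y∈fan , inj₁ (≤-pred y<w))
    ... | inj₂ y≡w = inj₁ y≡w
    to (y∈fan , inj₂ β≤y) = inj₂ (y∈fan , inj₂ β≤y)
    from : y ≡ suc α ⊎ FanOutside α β y → FanOutside (suc α) β y
    from (inj₁ refl) = w∈fan , inj₁ ≤-refl
    from (inj₂ (y∈fan , inj₁ y≤α)) = y∈fan , inj₁ (m≤n⇒m≤1+n y≤α)
    from (inj₂ (y∈fan , inj₂ β≤y)) = y∈fan , inj₂ β≤y
  ear-fan {α} {w = w} (right-ear refl) w∈fan y = mk⇔ to from
    where
    to : FanOutside α w y → y ≡ w ⊎ FanOutside α (suc w) y
    to (y∈fan , inj₁ y≤α) = inj₂ (y∈fan , inj₁ y≤α)
    to (y∈fan , inj₂ w≤y) with m≤n⇒m<n∨m≡n w≤y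
    ... | inj₁ w<y = inj₂ (y∈fan , inj₂ w<y)
    ... | inj₂ w≡y = inj₁ (sym w≡y)
    from : y ≡ w ⊎ FanOutside α (suc w) y → FanOutside α w y
    from (inj₁ refl) = w∈fan , inj₂ ≤-refl
    from (inj₂ (y∈fan , inj₁ y≤α)) = y∈fan , inj₁ y≤α
    from (inj₂ (y∈fan , inj₂ β≤y)) = y∈fan , inj₂ (≤-trans (n≤1+n _) β≤y)

  partialStar-fan : ∀ {α β π U y} → PartialStar α β π U → FanOutside α β y → chord 0 y ∈ U
  partialStar-fan ps y∈fan = Equivalence.from (ps _) (inj₁ (_ , y∈fan , refl))

  partialStar-side : ∀ {α β π U a b} → PartialStar α β π U → (∀ {e} → e ∈ T → Inside α β e → e ∈ π) →
                     α ≤ a → a < b → b ≤ β → SideIn T a b → SideIn U a b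
  partialStar-side ps inside∈π α≤a a<b b≤β (inj₁ ab) = inj₁ ab
  partialStar-side ps inside∈π α≤a a<b b≤β (inj₂ ab∈T) =
    inj₂ (Equivalence.from (ps _) (inj₂ (inside∈π ab∈T (_ , _ , α≤a , a<b , b≤β , refl))))

  outer-flip : ∀ {α β w π U} → 1 ≤ α → α < w → w < β → β < n →
    PartialStar α β (chord α β ∷ π) U → SideIn U α w → SideIn U w β →
    Flip n U (chord α β) (chord 0 w ∷ removeSeg (chord α β) U)
  outer-flip {α} {β} {w} {π} {U} 1≤α α<w w<β β<n ps αw wβ =
    flip-intro αβ∈U (vertex-≢ 0<n w<n (<⇒≢ (≤-<-trans z≤n α<w))) (triangle-seg αβ≢ αβ0) (triangle-seg αβ≢ αβw)
    where
    α<β : α < β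
    α<β = <-trans α<w w<β
    w<n : w < n
    w<n = <-trans w<β β<n
    α<n : α < n
    α<n = <-trans α<β β<n
    αβ≢ : vertex α ≢ vertex β
    αβ≢ = vertex-≢ α<n β<n (<⇒≢ α<β)
    αβ∈U : chord α β ∈ U
    αβ∈U = Equivalence.from (ps _) (inj₂ (here refl))
    α0 : SideIn U α 0
    α0 with m≤n⇒m<n∨m≡n 1≤α
    ... | inj₁ 1<α = sideIn-sym (inj₂ (partialStar-fan ps ((1<α , ≤-<-trans α<β β<n) , inj₁ ≤-refl)))
    ... | inj₂ 1≡α = inj₁ (subst (λ a → Adjacent a 0) 1≡α (adjacent-sym (adjacent-suc 0)))
    β0 : SideIn U β 0
    β0 with m≤n⇒m<n∨m≡n β<n
    ... | inj₁ sβ<n = sideIn-sym (inj₂ (partialStar-fan ps ((≤-trans (s≤s 1≤α) α<β , sβ<n) , inj₂ ≤-refl)))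
    ... | inj₂ sβ≡n = inj₁ (adjacent-last sβ≡n)
    αβ0 : IsTriangle n U (vertex α) (vertex β) (vertex 0)
    αβ0 = triangle α<n β<n 0<n (<⇒≢ α<β) (m<n⇒n≢0 α<β) (m<n⇒n≢0 1≤α) (inj₂ αβ∈U) β0 α0
    αβw : IsTriangle n U (vertex α) (vertex β) (vertex w)
    αβw = triangle α<n β<n w<n (<⇒≢ α<β) (≢-sym (<⇒≢ w<β)) (<⇒≢ α<w) (inj₂ αβ∈U) (sideIn-sym wβ) αw

  outer-flip-partialStar : ∀ {α β w α′ β′ π U} → 1 ≤ α → α < β → β < n →
    (∀ y → FanOutside α′ β′ y ⇔ (y ≡ w ⊎ FanOutside α β y)) → ¬ chord α β ∈ π →
    PartialStar α β (chord α β ∷ π) U → PartialStar α′ β′ π (chord 0 w ∷ removeSeg (chord α β) U)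
  outer-flip-partialStar {α} {β} {w} {α′} {β′} {π} {U} 1≤α α<β β<n fan αβ∉π ps x = mk⇔ to from
    where
    fan≢αβ : ∀ {y} → InFan y → chord 0 y ≢ chord α β
    fan≢αβ {y} (2≤y , sy<n) eq =
      m<n⇒n≢0 1≤α (sym (proj₁ (chord-injective (≤-trans (s≤s z≤n) 2≤y) (<-trans (n<1+n y) sy<n) α<β β<n eq)))
    to : x ∈ chord 0 w ∷ removeSeg (chord α β) U → ∃[ y ] (FanOutside α′ β′ y × x ≡ chord 0 y) ⊎ x ∈ π
    to x∈U′ with Equivalence.to (∈-flipped {e = chord α β} {U = U}) x∈U′
    ... | inj₁ x≡0w = inj₁ (w , Equivalence.from (fan w) (inj₁ refl) , x≡0w)
    ... | inj₂ (x∈U , x≢αβ) with Equivalence.to (ps x) x∈U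
    ...   | inj₁ (y , y∈fan , x≡0y) = inj₁ (y , Equivalence.from (fan y) (inj₂ y∈fan) , x≡0y)
    ...   | inj₂ (here x≡αβ) = ⊥-elim (x≢αβ x≡αβ)
    ...   | inj₂ (there x∈π) = inj₂ x∈π
    from : ∃[ y ] (FanOutside α′ β′ y × x ≡ chord 0 y) ⊎ x ∈ π → x ∈ chord 0 w ∷ removeSeg (chord α β) U
    from (inj₁ (y , y∈fan′ , x≡0y)) with Equivalence.to (fan y) y∈fan′
    ... | inj₁ y≡w = here (trans x≡0y (cong (chord 0) y≡w))
    ... | inj₂ y∈fan = Equivalence.from (∈-flipped {U = U})
      (inj₂ (subst (_∈ U) (sym x≡0y) (partialStar-fan ps y∈fan) , λ x≡αβ → fan≢αβ (proj₁ y∈fan) (trans (sym x≡0y) x≡αβ)))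
    from (inj₂ x∈π) = Equivalence.from (∈-flipped {U = U})
      (inj₂ (Equivalence.from (ps x) (inj₂ (there x∈π)) , λ x≡αβ → αβ∉π (subst (_∈ π) x≡αβ x∈π)))

  ear-∈⇔ : ∀ {α β w α′ β′ π} → Ear α β w α′ β′ → α < w → w < β → β < n →
           chord α β ∈ T → SideIn T α w → SideIn T w β → (∀ e → e ∈ π ⇔ (e ∈ T × Inside α′ β′ e)) →
           ∀ e → e ∈ chord α β ∷ π ⇔ (e ∈ T × Inside α β e)
  ear-∈⇔ {α} {β} {π = π} ear α<w w<β β<n αβ∈T αw wβ ∈π⇔ e = mk⇔ to from
    where
    to : e ∈ chord α β ∷ π → e ∈ T × Inside α β e
    to (here e≡αβ) = subst (_∈ T) (sym e≡αβ) αβ∈T , α , β , ≤-refl , <-trans α<w w<β , ≤-refl , e≡αβ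
    to (there e∈π) with Equivalence.to (∈π⇔ e) e∈π
    ... | e∈T , inside = e∈T , inside-mono (proj₁ (ear-bounds ear)) (proj₂ (ear-bounds ear)) inside
    from : e ∈ T × Inside α β e → e ∈ chord α β ∷ π
    from (e∈T , inside) with e ≟ˢ chord α β
    ... | yes e≡αβ = here e≡αβ
    ... | no e≢αβ = there (Equivalence.from (∈π⇔ e) (e∈T , ear-narrow ear α<w w<β β<n αw wβ e∈T inside e≢αβ))

  record FlipOrder (α β : ℕ) : Set where
    field
      order   : List Seg
      order!  : Unique order
      ∈order⇔ : ∀ e → e ∈ order ⇔ (e ∈ T × Inside α β e)
      flips   : ∀ U → PartialStar α β order U → FlipSeq n U order S

  open FlipOrder

  edge-flipOrder : ∀ {α} → suc α < n → FlipOrder α (suc α)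
  edge-flipOrder sα<n .order = []
  edge-flipOrder sα<n .order! = []
  edge-flipOrder sα<n .∈order⇔ e = mk⇔ (λ ()) (λ (e∈T , inside) → ⊥-elim (¬inside-edge sα<n e∈T inside))
  edge-flipOrder {α} sα<n .flips U ps x = mk⇔ to from
    where
    to : x ∈ U → x ∈ S
    to x∈U with Equivalence.to (ps x) x∈U
    ... | inj₁ (y , (y∈fan , _) , x≡0y) = Equivalence.from (star x) (y , y∈fan , x≡0y)
    from : x ∈ S → x ∈ U
    from x∈S with Equivalence.to (star x) x∈S
    ... | y , y∈fan , x≡0y = Equivalence.from (ps x) (inj₁ (y , (y∈fan , ≤-<-connex y α) , x≡0y))

  ear-flipOrder : ∀ {α β w α′ β′} → Ear α β w α′ β′ → 1 ≤ α → α < w → w < β → β < n →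
                  chord α β ∈ T → SideIn T α w → SideIn T w β → FlipOrder α′ β′ → FlipOrder α β
  ear-flipOrder {α} {β} {w} {α′} {β′} ear 1≤α α<w w<β β<n αβ∈T αw wβ F = record
    { order = chord α β ∷ order F
    ; order! = All.tabulate (λ m eq → αβ∉F (subst (_∈ order F) (sym eq) m)) ∷ order! F
    ; ∈order⇔ = ∈order⇔′
    ; flips = λ U ps → _ , outer-flip 1≤α α<w w<β β<n ps (side ps ≤-refl α<w (<⇒≤ w<β) αw)
                                                          (side ps (<⇒≤ α<w) w<β ≤-refl wβ)
                         , flips F _ (outer-flip-partialStar 1≤α α<β β<n fan αβ∉F ps)
    }
    where
    α<β : α < β
    α<β = <-trans α<w w<β
    β′<n : β′ < n
    β′<n = ≤-<-trans (proj₂ (ear-bounds ear)) β<n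
    fan : ∀ y → FanOutside α′ β′ y ⇔ (y ≡ w ⊎ FanOutside α β y)
    fan = ear-fan ear (≤-trans (s≤s 1≤α) α<w , ≤-<-trans w<β β<n)
    αβ∉F : ¬ chord α β ∈ order F
    αβ∉F m with inside-chord β′<n α<β β<n (proj₂ (Equivalence.to (∈order⇔ F _) m)) | ear-shrinks ear
    ... | α′≤α , _ | inj₁ α<α′ = <⇒≱ α<α′ α′≤α
    ... | _ , β≤β′ | inj₂ β′<β = <⇒≱ β′<β β≤β′
    ∈order⇔′ : ∀ e → e ∈ chord α β ∷ order F ⇔ (e ∈ T × Inside α β e)
    ∈order⇔′ = ear-∈⇔ ear α<w w<β β<n αβ∈T αw wβ (∈order⇔ F)
    side : ∀ {U a b} → PartialStar α β (chord α β ∷ order F) U → α ≤ a → a < b → b ≤ β → SideIn T a b → SideIn U a b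
    side ps = partialStar-side ps (λ e∈T inside → Equivalence.from (∈order⇔′ _) (e∈T , inside))

  flipOrder : ∀ k {α β} → β ≡ suc (k + α) → 1 ≤ α → β < n → SideIn T α β → FlipOrder α β
  flipOrder zero refl 1≤α β<n _ = edge-flipOrder β<n
  flipOrder (suc k) {α} {β} β≡ 1≤α β<n αβ = peel (apex 1≤α α<β β<n αβ∈T)
    where
    sα<β : suc α < β
    sα<β = subst (suc α <_) (sym β≡) (s≤s (s≤s (m≤n+m α k)))
    α<β : α < β
    α<β = <-trans (n<1+n α) sα<β
    αβ∈T : chord α β ∈ T
    αβ∈T = sideIn-long 1≤α sα<β β<n αβ
    peel : Apex α β → FlipOrder α β
    peel (w , α<w , w<β , αw , wβ) with zigzag-ear 1≤α α<w w<β β<n αβ∈T αw wβ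
    ... | α′ , β′ , ear = ear-flipOrder ear 1≤α α<w w<β β<n αβ∈T αw wβ
      (flipOrder k (ear-length k ear β≡) (≤-trans 1≤α (proj₁ (ear-bounds ear)))
                   (≤-<-trans (proj₂ (ear-bounds ear)) β<n) (ear-side ear αw wβ))

  -- A diagonal crossing 1 β would have to end at vertex 0.
  first-side : ∀ {β} → 1 < β → suc β ≡ n → SideIn T 1 β
  first-side {β} 1<β sβ≡n = side (2 ≟ β) (chord 1 β ∈? T)
    where
    β<n : β < n
    β<n = subst (β <_) sβ≡n (n<1+n β)
    uncrossed : ¬ (∃[ p ] ∃[ q ] (p < q × q < n × chord p q ∈ T × Cross (1 , β) (p , q)))
    uncrossed (zero , q , 0<q , q<n , 0q∈T , _) = ¬chord0∈T 0<q q<n 0q∈T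
    uncrossed (suc p , q , _ , q<n , _ , inj₁ (_ , _ , β<q)) = <-irrefl sβ≡n (≤-<-trans β<q q<n)
    uncrossed (suc p , q , _ , _ , _ , inj₂ (s≤s () , _))
    side : Dec (2 ≡ β) → Dec (chord 1 β ∈ T) → SideIn T 1 β
    side (yes 2≡β) _ = inj₁ (subst (Adjacent 1) 2≡β (adjacent-suc 1))
    side (no _) (yes 1β∈T) = inj₂ 1β∈T
    side (no 2≢β) (no 1β∉T) =
      ⊥-elim (uncrossed (chord∉⇒crossed 1<β β<n (λ 1β → 2≢β (sym (adjacent⇒suc ≤-refl 1<β β<n 1β))) 1β∉T))

  inside-all : ∀ {β e} → suc β ≡ n → e ∈ T → Inside 1 β e
  inside-all sβ≡n e∈T with chord-of e∈T
  ... | zero , q , 0<q , q<n , refl = ⊥-elim (¬chord0∈T 0<q q<n e∈T)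
  ... | suc p , q , p<q , q<n , refl = suc p , q , s≤s z≤n , p<q , ≤-pred (subst (q <_) (sym sβ≡n) q<n) , refl

  zigzag⇒permAdjacent : ∀ k → 3 + k ≡ n → PermAdjacent n T S
  zigzag⇒permAdjacent k 3+k≡n = order F , order↭T , flips F T T-partialStar
    where
    F : FlipOrder 1 (2 + k)
    F = flipOrder k (cong suc (+-comm 1 k)) ≤-refl (subst (2 + k <_) 3+k≡n ≤-refl) (first-side (s≤s (s≤s z≤n)) 3+k≡n)
    order↭T : order F ↭ T
    order↭T = ∼bag⇒↭ (unique∧set⇒bag (order! F) noDup (λ {x} → mk⇔
      (λ x∈F → proj₁ (Equivalence.to (∈order⇔ F x) x∈F))
      (λ x∈T → Equivalence.from (∈order⇔ F x) (x∈T , inside-all 3+k≡n x∈T))))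
    T-partialStar : PartialStar 1 (2 + k) (order F) T
    T-partialStar x = mk⇔ (λ x∈T → inj₂ (Equivalence.from (∈order⇔ F x) (x∈T , inside-all 3+k≡n x∈T))) from
      where
      from : ∃[ y ] (FanOutside 1 (2 + k) y × x ≡ chord 0 y) ⊎ x ∈ order F → x ∈ T
      from (inj₁ (y , ((2≤y , _) , inj₁ y≤1) , _)) = ⊥-elim (<⇒≱ 2≤y y≤1)
      from (inj₁ (y , ((_ , sy<n) , inj₂ 2+k≤y) , _)) = ⊥-elim (<⇒≱ sy<n (subst (_≤ suc y) 3+k≡n (s≤s 2+k≤y)))
      from (inj₂ x∈F) = proj₁ (Equivalence.to (∈order⇔ F x) x∈F)

lemma3p1 : (n : ℕ) (T : List Seg) → Triangulation n T → Zigzag n T →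
    (v : ℕ) → Endpoint n T v → (S : List Seg) → Star n S v →
    PermAdjacent n T S
lemma3p1 n T triT zigzag v (v<n , endpoint) S (triS , _ , center) =
  ZigzagFlips.zigzag⇒permAdjacent n v v<n triT zigzag endpoint (StarIsFan.star⇔fanChord n v v<n triS center)
    (n ∸ 3) (m+[n∸m]≡n (Triangulation.three≤n triT))
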